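{- Let $D$ be a non-elliptic web all of whose boundary vertices have degree exactly $1$, with boundary vertices numbered $1,\dots,n$ clockwise, and let $\ell_{KK}$ be the proper edge coloring of $D$ determined by the KK-labeling of $D$. Then $\ell_{KK}$ is lexicographically minimal: for every proper edge coloring $\ell$ of $D$, the boundary word of $\ell_{KK}$ is lexicographically less than or equal to the boundary word of $\ell$.
   Context: A tensor diagram is a finite bipartite graph with a fixed proper coloring of its vertices by black and white, a fixed partition of its vertices into boundary vertices and internal vertices, such that every internal vertex has degree $3$ and carries a fixed cyclic order of its incident edges. A web is a tensor diagram embedded in an oriented disk, with the boundary vertices on the boundary circle, whose edges do not cross or touch except at endpoints (considered up to isotopy fixing the boundary). A web is non-elliptic if it has no multiple edges and no $4$-cycle all of whose vertices are internal. A proper edge coloring of a web is an assignment of a color in $\{ -1,0,1\}$ to each edge such that the three edges at every internal vertex receive distinct colors. Sign and state strings: a sign and state string of length $n$ is a sequence $((s_1,j_1),\dots,(s_n,j_n))$ with $s_k\in\{+,-\}$ and $j_k\in\{ -1,0,1\}$. Assign weights in $\mathbb{R}^2$: $(+,1)\mapsto(1,0)$, $(+,0)\mapsto(-1/2,\sqrt3/2)$, $(+,-1)\mapsto(-1/2,-\sqrt3/2)$, and the weight of $(-,j)$ is the negative of the weight of $(+,-j)$. The path of the string is $\pi_0=0$, $\pi_k=\pi_{k-1}+(\text{weight of }(s_k,j_k))$. The string is dominant if $\pi_n=0$ and every $\pi_k$ lies in the dominant chamber $\{a(1,0)+b(1/2,\sqrt3/2): a,b\ge 0\}$. Growth algorithm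 (Khovanov–Kuperberg): place $n$ vertices on a horizontal segment in order $1,\dots,n$ from left to right, vertex $k$ black if $s_k=+$ and white if $s_k=-$, and draw a downward dangling edge from vertex $k$ labeled $(s_k,j_k)$. Repeatedly apply one of the following rules to two dangling edges that are adjacent in the current left-to-right order, labeled $(s,j)$ (left) and $(s',j')$ (right). If $s'=-s$: (i) if $(j,j')=(1,0)$, $(0,0)$, or $(0,-1)$, join each of the two edges to a new internal vertex, connect these two new vertices by a horizontal (unlabeled) edge, and from each new vertex draw one new downward dangling edge; the new left and right dangling edges are labeled $(-s,0),(s,1)$, resp. $(-s,-1),(s,1)$, resp. $(-s,-1),(s,0)$; (ii) if $(j,j')=(1,-1)$, join the two dangling edges into a single edge (no new dangling edge). If $s'=s$ and $(j,j')=(1,0)$, $(0,-1)$, or $(1,-1)$: join both edges to one new internal vertex and draw one new downward dangling edge labeled $(-s,1)$, resp. $(-s,-1)$, resp. $(-s,0)$. (New dangling edges replace the consumed ones in the left-to-right order.) Each edge thus receives the label $(\text{sign},\text{state})$ it was created with, except horizontal edges of rule (i), which are unlabeled, and edges created by rule (ii), which carry two labels. Finally the ends of the segment are joined so that the web lies in a disk and left-to-right becomes clockwise. Khovanov and Kuperberg showed that from a dominant string the algorithm always terminates with no dangling edges, the result is independent of the choices made and is a non-elliptic web with all boundary vertices of degree $1$, and conversely every such web with boundary vertices numbered $1,\dots,n$ clockwise arises in this way from exactly one dominant sign and state string, whose sign string has $s_k=+$ iff vertex $k$ is black. The state string $(j_1,\dots,j_n)$ of that string is the KK-labeling of the web.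 The proper edge coloring determined by the KK-labeling: run the growth algorithm; an edge with label $(+,j)$ gets color $j$, an edge with label $(-,j)$ gets color $-j$ (for edges with two labels both give the same color), and each unlabeled horizontal edge gets the unique color making the coloring proper. Lexicographic order: for a web with all boundary vertices of degree $1$, numbered $1,\dots,n$ clockwise, and a proper edge coloring $\ell$, the boundary word of $\ell$ is $(c_1,\dots,c_n)$ where $c_k$ is the color of the edge at boundary vertex $k$. Boundary words are compared lexicographically, where at positions of black vertices colors are ordered $1<0<-1$ and at positions of white vertices colors are ordered $-1<0<1$. -}

module Defs where

open import Data.Nat using (ℕ; zero; suc; _≤_; _+_)
open import Data.Integer as ℤ using (ℤ; +_; -[1+_]) renaming (_+_ to _+ℤ_; _≤_ to _≤ℤ_)
open import Data.Fin using (Fin; zero; suc)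
open import Data.List using (List; []; _∷_; _++_; length; lookup)
open import Data.Vec using (Vec; []; _∷_)
open import Data.Product using (_×_; _,_; proj₁; proj₂; ∃)
open import Data.Unit using (⊤)
open import Data.Sum using (_⊎_)
open import Relation.Binary.PropositionalEquality using (_≡_; _≢_)
open import Data.Nat using (_<_)

data Sign : Set where
  plus minus : Sign

negS : Sign → Sign
negS plus  = minus
negS minus = plus

-- states and edge colors both range over {-1,0,1}
data Col : Set where
  m1 c0 p1 : Col

negC : Col → Col
negC m1 = p1
negC c0 = c0
negC p1 = m1

labelColor : Sign → Col → Col
labelColor plus  j = j
labelColor minus j = negC j

third : Col → Col → Col
third m1 c0 = p1
third c0 m1 = p1
third m1 p1 = c0
third p1 m1 = c0
third c0 p1 = m1
third p1 c0 = m1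
third _  _  = c0   -- unused (arguments equal)

-- Weights, written in the basis e₁ = (1,0), e₂ = (1/2, √3/2) of ℝ².
-- (+,1) ↦ (1,0) = e₁ ; (+,0) ↦ (-1/2,√3/2) = -e₁+e₂ ; (+,-1) ↦ (-1/2,-√3/2) = -e₂
-- weight (-,j) = - weight (+,-j).  The dominant chamber is {a e₁ + b e₂ : a,b ≥ 0}.

weightPlus : Col → ℤ × ℤ
weightPlus p1 = (+ 1 , + 0)
weightPlus c0 = (-[1+ 0 ] , + 1)
weightPlus m1 = (+ 0 , -[1+ 0 ])

weight : Sign × Col → ℤ × ℤ
weight (plus  , j) = weightPlus j
weight (minus , j) = (ℤ.- proj₁ (weightPlus (negC j)) , ℤ.- proj₂ (weightPlus (negC j)))

DominantFrom : ∀ {n} → ℤ → ℤ → Vec (Sign × Col) n → Set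
DominantFrom a b [] = (a ≡ + 0) × (b ≡ + 0)
DominantFrom a b (x ∷ w) =
  ((+ 0 ≤ℤ (a +ℤ proj₁ (weight x))) × (+ 0 ≤ℤ (b +ℤ proj₂ (weight x))))
  × DominantFrom (a +ℤ proj₁ (weight x)) (b +ℤ proj₂ (weight x)) w

Dominant : ∀ {n} → Vec (Sign × Col) n → Set
Dominant w = DominantFrom (+ 0) (+ 0) w

signsOf : ∀ {n} → Vec (Sign × Col) n → Vec Sign n
signsOf [] = []
signsOf ((s , _) ∷ w) = s ∷ signsOf w

-- Vertices are natural numbers: boundary vertex k (k = 1..n) is the
-- number k-1; internal vertices are numbered n, n+1, ...
-- An edge is (u , v , c): endpoints u, v and its KK-color c.

Edge : Set
Edge = ℕ × ℕ × Col

-- a dangling edge: its (already present) top vertex and its label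
Dangling : Set
Dangling = ℕ × Sign × Col

record State : Set where
  constructor st
  field
    dangling : List Dangling   -- in left-to-right order
    next     : ℕ
    edges    : List Edge

-- rule (i): (j , j') ↦ new labels' states (j₁ , j₂); new labels are (-s,j₁),(s,j₂)
data HRule : Col → Col → Col → Col → Set where
  h10 : HRule p1 c0 c0 p1
  h00 : HRule c0 c0 m1 p1
  h0m : HRule c0 m1 m1 c0

-- same-sign rule: (j , j') ↦ state of new label (-s , j'')
data YRule : Col → Col → Col → Set where
  y10 : YRule p1 c0 p1
  y0m : YRule c0 m1 m1
  y1m : YRule p1 m1 c0

data Step : State → State → Set where
  stepH : ∀ pre post u v s j j' j₁ j₂ c es → HRule j j' j₁ j₂ →
    Step (st (pre ++ (u , s , j) ∷ (v , negS s , j') ∷ post) c es)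
         (st (pre ++ (c , negS s , j₁) ∷ (suc c , s , j₂) ∷ post) (suc (suc c))
             ((u , c , labelColor s j)
              ∷ (v , suc c , labelColor (negS s) j')
              ∷ (c , suc c , third (labelColor s j) (labelColor (negS s) j₁))
              ∷ es))
  stepJ : ∀ pre post u v s c es →
    Step (st (pre ++ (u , s , p1) ∷ (v , negS s , m1) ∷ post) c es)
         (st (pre ++ post) c ((u , v , labelColor s p1) ∷ es))
  stepY : ∀ pre post u v s j j' j'' c es → YRule j j' j'' →
    Step (st (pre ++ (u , s , j) ∷ (v , s , j') ∷ post) c es)
         (st (pre ++ (c , negS s , j'') ∷ post) (suc c)
             ((u , c , labelColor s j) ∷ (v , c , labelColor s j') ∷ es))

data Steps : State → State → Set where
  done : ∀ {σ} → Steps σ σ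
  _◅_  : ∀ {σ τ ρ} → Step σ τ → Steps τ ρ → Steps σ ρ

initDangling : ∀ {n} → ℕ → Vec (Sign × Col) n → List Dangling
initDangling k [] = []
initDangling k ((s , j) ∷ w) = (k , s , j) ∷ initDangling (suc k) w

initial : ∀ {n} → Vec (Sign × Col) n → State
initial {n} w = st (initDangling 0 w) n []

GrowsTo : ∀ {n} → Vec (Sign × Col) n → List Edge → Set
GrowsTo w es = ∃ λ m → Steps (initial w) (st [] m es)

Incident : (es : List Edge) → ℕ → Fin (length es) → Set
Incident es x e = (proj₁ (lookup es e) ≡ x) ⊎ (proj₁ (proj₂ (lookup es e)) ≡ x)

Proper : ℕ → (es : List Edge) → (Fin (length es) → Col) → Set
Proper n es ℓ = ∀ x → n ≤ x → ∀ e e' → e ≢ e' →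
  Incident es x e → Incident es x e' → ℓ e ≢ ℓ e'

kkColoring : (es : List Edge) → Fin (length es) → Col
kkColoring es e = proj₂ (proj₂ (lookup es e))

BoundaryWordFrom : ∀ {n} → (es : List Edge) → (Fin (length es) → Col) → ℕ → Vec Col n → Set
BoundaryWordFrom es ℓ k [] = ⊤
BoundaryWordFrom es ℓ k (c ∷ b) =
  (∀ e → Incident es k e → ℓ e ≡ c) × BoundaryWordFrom es ℓ (suc k) b

BoundaryWord : ∀ {n} → (es : List Edge) → (Fin (length es) → Col) → Vec Col n → Set
BoundaryWord es ℓ b = BoundaryWordFrom es ℓ 0 b

rank : Sign → Col → ℕ
rank plus  p1 = 0
rank plus  c0 = 1
rank plus  m1 = 2
rank minus m1 = 0
rank minus c0 = 1
rank minus p1 = 2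

data LexLeq : ∀ {n} → Vec Sign n → Vec Col n → Vec Col n → Set where
  lex-[] : LexLeq [] [] []
  lex-<  : ∀ {n s x y} {ss : Vec Sign n} {xs ys} →
           rank s x < rank s y → LexLeq (s ∷ ss) (x ∷ xs) (y ∷ ys)
  lex-≡  : ∀ {n s x} {ss : Vec Sign n} {xs ys} →
           LexLeq ss xs ys → LexLeq (s ∷ ss) (x ∷ xs) (x ∷ ys)

{-# OPTIONS --safe #-}
module Submission where

-- Follow a run of the growth algorithm backwards. At each stage compare lexicographically, in
-- the sign-dependent order, the KK labels of the dangling edges with the colours ℓ gives to the
-- edges that will later hang from them: before the first step these are the two boundary words,
-- after the last step both are empty. A step replaces two adjacent dangling edges by at most two
-- new ones at fresh internal vertices, and properness of ℓ there forces each new dangling edge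
-- to carry the third colour. For each growth rule a finite check then shows that the block
-- before the step compares no higher than the block after it, so the comparison, "equal" at
-- the end of the run, is at most "equal" at its start.

open import Defs
open import Data.Nat using (ℕ; zero; suc; _≤_; _<_; _+_; z≤n; s≤s)
open import Data.Nat.Properties
  using (≤-refl; suc-injective; <⇒≢; <-≤-trans; m≤n⇒m≤1+n; m≤m+n; +-monoʳ-<; +-cancelˡ-≡)
open import Data.Vec using (Vec; []; _∷_; toList)
open import Data.List using (List; []; _∷_; _++_; length; lookup)
open import Data.List.Properties using (++-assoc; length-++; length-++-≤ˡ)
open import Data.List.Relation.Unary.All using (All; []; _∷_)
open import Data.List.Relation.Unary.All.Properties using (++⁻ˡ; ++⁻ʳ; ++⁺)
open import Data.List.Relation.Binary.Pointwise as Pointwise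
  using (Pointwise; []; _∷_; Pointwise-length)
open import Data.Fin using (Fin; zero; suc; toℕ)
open import Data.Product using (_×_; _,_; proj₁; proj₂; Σ-syntax; ∃₂)
open import Data.Sum using (inj₁; inj₂)
open import Data.Empty using (⊥)
open import Data.Unit using (⊤; tt)
open import Function using (_∘_)
open import Function.Definitions using (Injective)
open import Relation.Nullary using (contradiction)
open import Relation.Binary.PropositionalEquality
  using (_≡_; _≢_; refl; sym; trans; cong; subst; subst₂; module ≡-Reasoning)

data Ordering : Set where
  less equal greater : Ordering

infixr 5 _⊕_
_⊕_ : Ordering → Ordering → Ordering
less    ⊕ _ = less
equal   ⊕ o = o
greater ⊕ _ = greater

⊕-assoc : ∀ o p q → (o ⊕ p) ⊕ q ≡ o ⊕ (p ⊕ q)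
⊕-assoc less    _ _ = refl
⊕-assoc equal   _ _ = refl
⊕-assoc greater _ _ = refl

infix 4 _≼_
_≼_ : Ordering → Ordering → Set
less    ≼ _       = ⊤
equal   ≼ less    = ⊥
equal   ≼ _       = ⊤
greater ≼ greater = ⊤
greater ≼ _       = ⊥

≼-refl : ∀ o → o ≼ o
≼-refl less    = tt
≼-refl equal   = tt
≼-refl greater = tt

≼-trans : ∀ {o p q} → o ≼ p → p ≼ q → o ≼ q
≼-trans {less}                        _ _ = tt
≼-trans {equal}   {equal}             _ q = q
≼-trans {equal}   {greater} {greater} _ _ = tt
≼-trans {greater} {greater}           _ q = q

⊕-monoˡ-≼ : ∀ {o o'} r → o ≼ o' → o ⊕ r ≼ o' ⊕ r
⊕-monoˡ-≼ {less}              _       _ = tt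
⊕-monoˡ-≼ {equal}   {equal}   r       _ = ≼-refl r
⊕-monoˡ-≼ {equal}   {greater} less    _ = tt
⊕-monoˡ-≼ {equal}   {greater} equal   _ = tt
⊕-monoˡ-≼ {equal}   {greater} greater _ = tt
⊕-monoˡ-≼ {greater} {greater} _       _ = tt

⊕-monoʳ-≼ : ∀ o {r r'} → r ≼ r' → o ⊕ r ≼ o ⊕ r'
⊕-monoʳ-≼ less    _ = tt
⊕-monoʳ-≼ equal   p = p
⊕-monoʳ-≼ greater _ = tt

compareℕ : ℕ → ℕ → Ordering
compareℕ zero    zero    = equal
compareℕ zero    (suc _) = less
compareℕ (suc _) zero    = greater
compareℕ (suc m) (suc n) = compareℕ m n

compareℕ-less : ∀ m n → compareℕ m n ≡ less → m < n
compareℕ-less zero    (suc n) _  = s≤s z≤n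
compareℕ-less (suc m) (suc n) eq = s≤s (compareℕ-less m n eq)

compareℕ-equal : ∀ m n → compareℕ m n ≡ equal → m ≡ n
compareℕ-equal zero    zero    _  = refl
compareℕ-equal (suc m) (suc n) eq = cong suc (compareℕ-equal m n eq)

colourOfRank : Sign → ℕ → Col
colourOfRank plus  0 = p1
colourOfRank plus  1 = c0
colourOfRank plus  _ = m1
colourOfRank minus 0 = m1
colourOfRank minus 1 = c0
colourOfRank minus _ = p1

colourOfRank-rank : ∀ s x → colourOfRank s (rank s x) ≡ x
colourOfRank-rank plus  m1 = refl
colourOfRank-rank plus  c0 = refl
colourOfRank-rank plus  p1 = refl
colourOfRank-rank minus m1 = refl
colourOfRank-rank minus c0 = refl
colourOfRank-rank minus p1 = refl

rank-injective : ∀ s → Injective _≡_ _≡_ (rank s)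
rank-injective s {x} {y} eq = begin
  x                         ≡⟨ sym (colourOfRank-rank s x) ⟩
  colourOfRank s (rank s x) ≡⟨ cong (colourOfRank s) eq ⟩
  colourOfRank s (rank s y) ≡⟨ colourOfRank-rank s y ⟩
  y                         ∎
  where open ≡-Reasoning

compareAt : Sign → Col → Col → Ordering
compareAt s x y = compareℕ (rank s x) (rank s y)

compareKK : List Dangling → List Col → Ordering
compareKK ((_ , s , j) ∷ D) (a ∷ A) = compareAt s (labelColor s j) a ⊕ compareKK D A
compareKK _                 _       = equal

compareKK-++ : ∀ D {D' A A'} → length D ≡ length A →
  compareKK (D ++ D') (A ++ A') ≡ compareKK D A ⊕ compareKK D' A'
compareKK-++ []                {A = []}    _   = refl
compareKK-++ ((_ , s , j) ∷ D) {A = a ∷ A} len =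
  trans (cong (compareAt s (labelColor s j) a ⊕_) (compareKK-++ D (suc-injective len)))
        (sym (⊕-assoc (compareAt s (labelColor s j) a) _ _))

-- A record rather than a bare inequality, so that the four blocks can be inferred from a proof.
record LocalMove (X : List Dangling) (Z : List Col) (X' : List Dangling) (Z' : List Col) : Set where
  constructor move
  field compare-≼ : compareKK X Z ≼ compareKK X' Z'

-- On closed blocks the comparison evaluates to ⊤ or ⊥, so ✓ checks a local move by evaluation.
pattern ✓ = move tt

compareKK-replace : ∀ pre {X X' post A₁ Z Z' A₃} →
  length pre ≡ length A₁ → length X ≡ length Z → length X' ≡ length Z' → LocalMove X Z X' Z' →
  compareKK (pre ++ X' ++ post) (A₁ ++ Z' ++ A₃) ≼ equal →
  compareKK (pre ++ X ++ post) (A₁ ++ Z ++ A₃) ≼ equal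
compareKK-replace pre {X} {X'} {post} {A₁} {Z} {Z'} {A₃} |pre| |X| |X'| (move X≼X') after≼equal =
  ≼-trans (subst₂ _≼_ (sym (split X |X|)) (sym (split X' |X'|))
            (⊕-monoʳ-≼ (compareKK pre A₁) (⊕-monoˡ-≼ (compareKK post A₃) X≼X')))
          after≼equal
  where
  split : ∀ Y {W} → length Y ≡ length W →
    compareKK (pre ++ Y ++ post) (A₁ ++ W ++ A₃)
      ≡ compareKK pre A₁ ⊕ compareKK Y W ⊕ compareKK post A₃
  split Y |Y| = trans (compareKK-++ pre |pre|) (cong (compareKK pre A₁ ⊕_) (compareKK-++ Y |Y|))

rotate : Col → Col
rotate m1 = c0
rotate c0 = p1
rotate p1 = m1

every : ∀ {P : Col → Set} → P m1 → P c0 → P p1 → ∀ x → P x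
every p _ _ m1 = p
every _ q _ c0 = q
every _ _ r p1 = r

avoiding : ∀ {h} {P : Col → Set} → P (rotate h) → P (rotate (rotate h)) → ∀ x → x ≢ h → P x
avoiding {m1} _ _ m1 x≢h = contradiction refl x≢h
avoiding {m1} p _ c0 _   = p
avoiding {m1} _ q p1 _   = q
avoiding {c0} _ q m1 _   = q
avoiding {c0} _ _ c0 x≢h = contradiction refl x≢h
avoiding {c0} p _ p1 _   = p
avoiding {p1} p _ m1 _   = p
avoiding {p1} _ q c0 _   = q
avoiding {p1} _ _ p1 x≢h = contradiction refl x≢h

avoiding² : ∀ {h} {P : Col → Col → Set} →
  P (rotate h) (rotate h) → P (rotate h) (rotate (rotate h)) →
  P (rotate (rotate h)) (rotate h) → P (rotate (rotate h)) (rotate (rotate h)) →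
  ∀ a → a ≢ h → ∀ b → b ≢ h → P a b
avoiding² p q r s = avoiding (avoiding p q) (avoiding r s)

third-unique : ∀ b a → a ≢ b → ∀ x → x ≢ b → x ≢ a → x ≡ third a b
third-unique = every (avoiding² absurd (λ _ → refl) (λ _ → refl) absurd)
                     (avoiding² absurd (λ _ → refl) (λ _ → refl) absurd)
                     (avoiding² absurd (λ _ → refl) (λ _ → refl) absurd)
  where
  absurd : ∀ {x : Col} {A : Set} → x ≢ x → A
  absurd = contradiction refl

yRule-local : ∀ s {j j' j''} → YRule j j' j'' → ∀ {u v c} b a → a ≢ b →
  LocalMove ((u , s , j) ∷ (v , s , j') ∷ []) (a ∷ b ∷ [])
            ((c , negS s , j'') ∷ []) (third a b ∷ [])
yRule-local plus  y10 = every (avoiding ✓ ✓) (avoiding ✓ ✓) (avoiding ✓ ✓)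
yRule-local plus  y0m = every (avoiding ✓ ✓) (avoiding ✓ ✓) (avoiding ✓ ✓)
yRule-local plus  y1m = every (avoiding ✓ ✓) (avoiding ✓ ✓) (avoiding ✓ ✓)
yRule-local minus y10 = every (avoiding ✓ ✓) (avoiding ✓ ✓) (avoiding ✓ ✓)
yRule-local minus y0m = every (avoiding ✓ ✓) (avoiding ✓ ✓) (avoiding ✓ ✓)
yRule-local minus y1m = every (avoiding ✓ ✓) (avoiding ✓ ✓) (avoiding ✓ ✓)

hRule-local : ∀ s {j j' j₁ j₂} → HRule j j' j₁ j₂ → ∀ {u v c} h a → a ≢ h → ∀ b → b ≢ h →
  LocalMove ((u , s , j) ∷ (v , negS s , j') ∷ []) (a ∷ b ∷ [])
            ((c , negS s , j₁) ∷ (suc c , s , j₂) ∷ []) (third a h ∷ third b h ∷ [])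
hRule-local plus  h10 = every (avoiding² ✓ ✓ ✓ ✓) (avoiding² ✓ ✓ ✓ ✓) (avoiding² ✓ ✓ ✓ ✓)
hRule-local plus  h00 = every (avoiding² ✓ ✓ ✓ ✓) (avoiding² ✓ ✓ ✓ ✓) (avoiding² ✓ ✓ ✓ ✓)
hRule-local plus  h0m = every (avoiding² ✓ ✓ ✓ ✓) (avoiding² ✓ ✓ ✓ ✓) (avoiding² ✓ ✓ ✓ ✓)
hRule-local minus h10 = every (avoiding² ✓ ✓ ✓ ✓) (avoiding² ✓ ✓ ✓ ✓) (avoiding² ✓ ✓ ✓ ✓)
hRule-local minus h00 = every (avoiding² ✓ ✓ ✓ ✓) (avoiding² ✓ ✓ ✓ ✓) (avoiding² ✓ ✓ ✓ ✓)
hRule-local minus h0m = every (avoiding² ✓ ✓ ✓ ✓) (avoiding² ✓ ✓ ✓ ✓) (avoiding² ✓ ✓ ✓ ✓)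

jRule-local : ∀ s {u v} a → LocalMove ((u , s , p1) ∷ (v , negS s , m1) ∷ []) (a ∷ a ∷ []) [] []
jRule-local plus  = every ✓ ✓ ✓
jRule-local minus = every ✓ ✓ ✓

pointwise-++⁻ : ∀ {A B : Set} {R : A → B → Set} xs {xs' ys} → Pointwise R (xs ++ xs') ys →
  ∃₂ λ ys₁ ys₂ → ys ≡ ys₁ ++ ys₂ × Pointwise R xs ys₁ × Pointwise R xs' ys₂
pointwise-++⁻ []       rs       = [] , _ , refl , [] , rs
pointwise-++⁻ (x ∷ xs) (r ∷ rs) with pointwise-++⁻ xs rs
... | ys₁ , ys₂ , refl , rs₁ , rs₂ = _ ∷ ys₁ , ys₂ , refl , r ∷ rs₁ , rs₂

record Located (es : List Edge) (p : ℕ) (x : Edge) : Set where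
  field
    index        : Fin (length es)
    toℕ-index    : toℕ index ≡ p
    lookup-index : lookup es index ≡ x

open Located

located-∷ : ∀ {e es p x} → Located es p x → Located (e ∷ es) (suc p) x
located-∷ l = record
  { index = suc (index l) ; toℕ-index = cong suc (toℕ-index l) ; lookup-index = lookup-index l }

locate : ∀ {es : List Edge} P Q {x} R → es ≡ P ++ Q ++ x ∷ R → Located es (length P + length Q) x
locate []      []      R refl = record { index = zero ; toℕ-index = refl ; lookup-index = refl }
locate []      (_ ∷ Q) R refl = located-∷ (locate [] Q R refl)
locate (_ ∷ P) Q       R refl = located-∷ (locate P Q R refl)

module _ {es : List Edge} {p : ℕ} {u v : ℕ} {k : Col} (l : Located es p (u , v , k)) where

  source : Incident es u (index l)
  source = inj₁ (cong proj₁ (lookup-index l))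

  target : Incident es v (index l)
  target = inj₂ (cong (proj₁ ∘ proj₂) (lookup-index l))

  kk-index : kkColoring es (index l) ≡ k
  kk-index = cong (proj₂ ∘ proj₂) (lookup-index l)

module _ {es : List Edge} (P : List Edge) {q : ℕ} {x : Edge} (l : Located es (length P + q) x) where

  after : length P ≤ toℕ (index l)
  after = subst (length P ≤_) (sym (toℕ-index l)) (m≤m+n (length P) q)

  within : ∀ N → q < length N → toℕ (index l) < length (P ++ N)
  within N q<N = subst₂ _<_ (sym (toℕ-index l)) (sym (length-++ P)) (+-monoʳ-< (length P) q<N)

located-≢ : ∀ {es x y} m {q q'} (l : Located es (m + q) x) (l' : Located es (m + q') y) →
  q ≢ q' → index l ≢ index l'
located-≢ m l l' q≢q' eq =
  q≢q' (+-cancelˡ-≡ m _ _ (trans (sym (toℕ-index l)) (trans (cong toℕ eq) (toℕ-index l'))))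

created : ∀ {σ τ} → Steps σ τ → List Edge
created done = []
created (stepH _ _ u v s j j' j₁ _ c _ _ ◅ rest) = created rest ++
  (u , c , labelColor s j) ∷ (v , suc c , labelColor (negS s) j')
    ∷ (c , suc c , third (labelColor s j) (labelColor (negS s) j₁)) ∷ []
created (stepJ _ _ u v s _ _ ◅ rest) = created rest ++ (u , v , labelColor s p1) ∷ []
created (stepY _ _ u v s j j' _ c _ _ ◅ rest) = created rest ++
  (u , c , labelColor s j) ∷ (v , c , labelColor s j') ∷ []

created-++ : ∀ {σ D m es} (run : Steps σ (st D m es)) → es ≡ created run ++ State.edges σ
created-++ done = refl
created-++ (stepH _ _ _ _ _ _ _ _ _ _ E _ ◅ rest) =
  trans (created-++ rest) (sym (++-assoc (created rest) _ E))
created-++ (stepJ _ _ _ _ _ _ E ◅ rest) =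
  trans (created-++ rest) (sym (++-assoc (created rest) _ E))
created-++ (stepY _ _ _ _ _ _ _ _ _ E _ ◅ rest) =
  trans (created-++ rest) (sym (++-assoc (created rest) _ E))

module _ (es : List Edge) (ℓ : Fin (length es) → Col) where

  -- es lists edges newest first: if k edges are created after some stage of the run, they are
  -- the first k edges of es, and among them is the edge that will hang from a dangling edge at u.
  FutureColourAt : ℕ → ℕ → Col → Set
  FutureColourAt k u a = ∀ e → toℕ e < k → Incident es u e → ℓ e ≡ a

  FutureColour : ℕ → Dangling → Col → Set
  FutureColour k d = FutureColourAt k (proj₁ d)

  futureColours-step : ∀ (P N : List Edge) {pre X post A₁ Z A₃} →
    Pointwise (FutureColour (length (P ++ N))) pre A₁ →
    Pointwise (FutureColour (length P)) X Z →
    Pointwise (FutureColour (length (P ++ N))) post A₃ →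
    Pointwise (FutureColour (length P)) (pre ++ X ++ post) (A₁ ++ Z ++ A₃)
  futureColours-step P N at-pre at-X at-post =
    Pointwise.++⁺ (earlier at-pre) (Pointwise.++⁺ at-X (earlier at-post))
    where
    earlier : ∀ {D A} → Pointwise (FutureColour (length (P ++ N))) D A →
      Pointwise (FutureColour (length P)) D A
    earlier = Pointwise.map λ at e e<P → at e (<-≤-trans e<P (length-++-≤ˡ P))

  jStep-colours : ∀ P {u v k E} → let N = (u , v , k) ∷ [] in es ≡ P ++ N ++ E →
    ∀ {a b} → FutureColourAt (length (P ++ N)) u a → FutureColourAt (length (P ++ N)) v b → a ≡ b
  jStep-colours P {u} {v} {k} es≡ at-u at-v =
    trans (sym (at-u _ x<P (source x))) (at-v _ x<P (target x))
    where
    x : Located es (length P + 0) (u , v , k)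
    x = locate P [] _ es≡
    x<P : toℕ (index x) < length (P ++ (u , v , k) ∷ [])
    x<P = within P x _ (s≤s z≤n)

  boundary-futureColours : ∀ {n'} j (w : Vec (Sign × Col) n') {k} {b : Vec Col n'} →
    BoundaryWordFrom es ℓ j b → Pointwise (FutureColour k) (initDangling j w) (toList b)
  boundary-futureColours j []      {b = []}    _             = []
  boundary-futureColours j (_ ∷ w) {b = _ ∷ _} (at-j , word) =
    (λ e _ → at-j e) ∷ boundary-futureColours (suc j) w word

  module _ {n : ℕ} (proper : Proper n es ℓ) where

    third-colour-at : ∀ {c} → n ≤ c →
      ∀ {e₁ e₂ k} → Incident es c e₁ → Incident es c e₂ → e₁ ≢ e₂ → k ≤ toℕ e₁ → k ≤ toℕ e₂ →
      ∀ {a b} → ℓ e₁ ≡ a → ℓ e₂ ≡ b → a ≢ b × FutureColourAt k c (third a b)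
    third-colour-at {c} n≤c {e₁} {e₂} {k} at₁ at₂ e₁≢e₂ k≤e₁ k≤e₂ refl refl =
      a≢b , λ e e<k at → third-unique _ _ a≢b _ (differs e<k k≤e₂ at at₂) (differs e<k k≤e₁ at at₁)
      where
      a≢b : ℓ e₁ ≢ ℓ e₂
      a≢b = proper c n≤c e₁ e₂ e₁≢e₂ at₁ at₂
      differs : ∀ {e e'} → toℕ e < k → k ≤ toℕ e' → Incident es c e → Incident es c e' → ℓ e ≢ ℓ e'
      differs e<k k≤e' at at' = proper c n≤c _ _ (<⇒≢ (<-≤-trans e<k k≤e') ∘ cong toℕ) at at'

    yStep-colours : ∀ {c} → n ≤ c → ∀ P {u v k₁ k₂ E} →
      let N = (u , c , k₁) ∷ (v , c , k₂) ∷ [] in es ≡ P ++ N ++ E →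
      ∀ {a b} → FutureColourAt (length (P ++ N)) u a → FutureColourAt (length (P ++ N)) v b →
      a ≢ b × FutureColourAt (length P) c (third a b)
    yStep-colours {c} n≤c P {u} {v} {k₁} {k₂} es≡ at-u at-v =
      third-colour-at n≤c (target x) (target y) (located-≢ (length P) x y λ ())
        (after P x) (after P y)
        (at-u _ (within P x _ (s≤s z≤n)) (source x))
        (at-v _ (within P y _ (s≤s (s≤s z≤n))) (source y))
      where
      x : Located es (length P + 0) (u , c , k₁)
      x = locate P [] _ es≡
      y : Located es (length P + 1) (v , c , k₂)
      y = locate P (_ ∷ []) _ es≡

    hStep-colours : ∀ {c} → n ≤ c → ∀ P {u v k₁ k₂ k₃ E} →
      let N = (u , c , k₁) ∷ (v , suc c , k₂) ∷ (c , suc c , k₃) ∷ [] in es ≡ P ++ N ++ E →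
      ∀ {a b} → FutureColourAt (length (P ++ N)) u a → FutureColourAt (length (P ++ N)) v b →
      Σ[ h ∈ Col ] (a ≢ h × FutureColourAt (length P) c (third a h))
                 × (b ≢ h × FutureColourAt (length P) (suc c) (third b h))
    hStep-colours {c} n≤c P {u} {v} {k₁} {k₂} {k₃} es≡ at-u at-v =
      ℓ (index z) ,
      third-colour-at n≤c (target x) (source z) (located-≢ (length P) x z λ ())
        (after P x) (after P z) (at-u _ (within P x _ (s≤s z≤n)) (source x)) refl ,
      third-colour-at (m≤n⇒m≤1+n n≤c) (target y) (target z) (located-≢ (length P) y z λ ())
        (after P y) (after P z) (at-v _ (within P y _ (s≤s (s≤s z≤n))) (source y)) refl
      where
      x : Located es (length P + 0) (u , c , k₁)
      x = locate P [] _ es≡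
      y : Located es (length P + 1) (v , suc c , k₂)
      y = locate P (_ ∷ []) _ es≡
      z : Located es (length P + 2) (c , suc c , k₃)
      z = locate P (_ ∷ _ ∷ []) _ es≡

    kk-≼-futureColours : ∀ {D c E m} (run : Steps (st D c E) (st [] m es)) → n ≤ c →
      ∀ {A} → Pointwise (FutureColour (length (created run))) D A → compareKK D A ≼ equal
    kk-≼-futureColours done _ [] = tt
    kk-≼-futureColours (stepH pre post u v s j j' j₁ j₂ c E r ◅ rest) n≤c coloured
      with pointwise-++⁻ pre coloured
    ... | A₁ , a ∷ b ∷ A₃ , refl , at-pre , at-u ∷ at-v ∷ at-post
      with hStep-colours n≤c (created rest) (created-++ rest) at-u at-v
    ... | h , (a≢h , at-c) , (b≢h , at-c+1) =
      compareKK-replace pre (Pointwise-length at-pre) refl refl (hRule-local s r h a a≢h b b≢h)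
        (kk-≼-futureColours rest (m≤n⇒m≤1+n (m≤n⇒m≤1+n n≤c))
          (futureColours-step (created rest) _ at-pre (at-c ∷ at-c+1 ∷ []) at-post))
    kk-≼-futureColours (stepJ pre post u v s c E ◅ rest) n≤c coloured
      with pointwise-++⁻ pre coloured
    ... | A₁ , a ∷ b ∷ A₃ , refl , at-pre , at-u ∷ at-v ∷ at-post
      with jStep-colours (created rest) (created-++ rest) at-u at-v
    ... | refl =
      compareKK-replace pre (Pointwise-length at-pre) refl refl (jRule-local s a)
        (kk-≼-futureColours rest n≤c (futureColours-step (created rest) _ at-pre [] at-post))
    kk-≼-futureColours (stepY pre post u v s j j' j'' c E r ◅ rest) n≤c coloured
      with pointwise-++⁻ pre coloured
    ... | A₁ , a ∷ b ∷ A₃ , refl , at-pre , at-u ∷ at-v ∷ at-post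
      with yStep-colours n≤c (created rest) (created-++ rest) at-u at-v
    ... | a≢b , at-c =
      compareKK-replace pre (Pointwise-length at-pre) refl refl (yRule-local s r b a a≢b)
        (kk-≼-futureColours rest (m≤n⇒m≤1+n n≤c)
          (futureColours-step (created rest) _ at-pre (at-c ∷ []) at-post))

data Realized (es : List Edge) : Dangling → Set where
  realized : ∀ {u s j} e → Incident es u e → kkColoring es e ≡ labelColor s j →
    Realized es (u , s , j)

realized-at-source : ∀ {es p u v s j} → Located es p (u , v , labelColor s j) →
  Realized es (u , s , j)
realized-at-source x = realized (index x) (source x) (kk-index x)

realized-at-target : ∀ {es p u v k s j} → Located es p (u , v , k) → k ≡ labelColor s j →
  Realized es (v , s , j)
realized-at-target x k≡ = realized (index x) (target x) (trans (kk-index x) k≡)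

labelColor-joined : ∀ s → labelColor s p1 ≡ labelColor (negS s) m1
labelColor-joined plus  = refl
labelColor-joined minus = refl

all-replace : ∀ {A : Set} {P : A → Set} pre X' {X post} →
  All P (pre ++ X' ++ post) → All P X → All P (pre ++ X ++ post)
all-replace pre X' all-X' all-X = ++⁺ (++⁻ˡ pre all-X') (++⁺ all-X (++⁻ʳ X' (++⁻ʳ pre all-X')))

dangling-realized : ∀ {D c E m es} (run : Steps (st D c E) (st [] m es)) → All (Realized es) D
dangling-realized done = []
dangling-realized {es = es} (stepH pre post u v s j j' j₁ j₂ c E r ◅ rest) =
  all-replace pre (_ ∷ _ ∷ []) (dangling-realized rest)
    (realized-at-source x ∷ realized-at-source y ∷ [])
  where
  x : Located es (length (created rest) + 0) (u , c , labelColor s j)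
  x = locate (created rest) [] _ (created-++ rest)
  y : Located es (length (created rest) + 1) (v , suc c , labelColor (negS s) j')
  y = locate (created rest) (_ ∷ []) _ (created-++ rest)
dangling-realized {es = es} (stepJ pre post u v s c E ◅ rest) =
  all-replace pre [] (dangling-realized rest)
    (realized-at-source x ∷ realized-at-target x (labelColor-joined s) ∷ [])
  where
  x : Located es (length (created rest) + 0) (u , v , labelColor s p1)
  x = locate (created rest) [] _ (created-++ rest)
dangling-realized {es = es} (stepY pre post u v s j j' j'' c E r ◅ rest) =
  all-replace pre (_ ∷ []) (dangling-realized rest)
    (realized-at-source x ∷ realized-at-source y ∷ [])
  where
  x : Located es (length (created rest) + 0) (u , c , labelColor s j)
  x = locate (created rest) [] _ (created-++ rest)
  y : Located es (length (created rest) + 1) (v , c , labelColor s j')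
  y = locate (created rest) (_ ∷ []) _ (created-++ rest)

lexLeq-∷ : ∀ {n s x y r} {ss : Vec Sign n} {xs ys} →
  compareAt s x y ⊕ r ≼ equal → (r ≼ equal → LexLeq ss xs ys) → LexLeq (s ∷ ss) (x ∷ xs) (y ∷ ys)
lexLeq-∷ {s = s} {x} {y} cmp rest with compareAt s x y in eq
... | less = lex-< (compareℕ-less (rank s x) (rank s y) eq)
... | equal with rank-injective s (compareℕ-equal (rank s x) (rank s y) eq)
...   | refl = lex-≡ (rest cmp)

boundary-lexLeq : ∀ {n} j (w : Vec (Sign × Col) n) {es b₁ b₂} →
  BoundaryWordFrom es (kkColoring es) j b₁ → All (Realized es) (initDangling j w) →
  compareKK (initDangling j w) (toList b₂) ≼ equal → LexLeq (signsOf w) b₁ b₂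
boundary-lexLeq j []            {b₁ = []}     {[]}     _ _ _ = lex-[]
boundary-lexLeq j ((s , _) ∷ w) {b₁ = x ∷ b₁} {y ∷ b₂} (kk-j , kk-word)
                (realized e at-j kk-e ∷ realized-w) cmp =
  lexLeq-∷ (subst (λ x → compareAt s x y ⊕ _ ≼ equal) (trans (sym kk-e) (kk-j e at-j)) cmp)
           (boundary-lexLeq (suc j) w kk-word realized-w)

theorem3p2 : ∀ {n} (w : Vec (Sign × Col) n) → Dominant w →
    ∀ (es : List Edge) → GrowsTo w es →
    ∀ (ℓ : Fin (length es) → Col) → Proper n es ℓ →
    ∀ (b₁ b₂ : Vec Col n) → BoundaryWord es (kkColoring es) b₁ → BoundaryWord es ℓ b₂ →
    LexLeq (signsOf w) b₁ b₂
-- Dominance of w only ensures that the growth algorithm terminates; here a complete run is given.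
theorem3p2 w _ es (_ , run) ℓ proper _ _ kk-word ℓ-word =
  boundary-lexLeq 0 w kk-word (dangling-realized run)
    (kk-≼-futureColours es ℓ proper run ≤-refl (boundary-futureColours es ℓ 0 w ℓ-word))
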